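{- Let $m\in \mathbb N$, let $L$ be a countable scattered linear order with $m(L)=m$, and let $L_0,\dots ,L_{m-1}\in \mathcal H$ be such that $L=L_0+\dots +L_{m-1}$. Let $\mathrm{Block}(L)=\{B_0,\dots ,B_r\}$ be the set of blocks of $L$ (with respect to this decomposition), where $B_0$ is the block containing $L_0$, so that $B_0=L_0+\dots+L_{n-1}$ for some $0<n\le m$. Then the set of blocks of $L\setminus B_0$, computed with respect to the decomposition $L\setminus B_0=L_n+\dots+L_{m-1}$, satisfies $\mathrm{Block}(L\setminus B_0)=\mathrm{Block}(L)\setminus \{B_0\}$.
   Context: A linear order is scattered iff the rational line does not embed into it. $\mathcal H$ (the hereditarily additively indecomposable orders) is the smallest class of order types of countable linear orders containing the one-element order type $\mathbf 1$ and containing the $\omega$-sum $\sum_\omega L_i$ and the $\omega^*$-sum $\sum_{\omega^*}L_i$ of every sequence $\langle L_i:i\in\omega\rangle$ in $\mathcal H$ satisfying: for every $i\in\omega$ the set $\{j\in\omega: L_i\hookrightarrow L_j\}$ is infinite. An element of $\mathcal H$ is called an $\omega$-sum (resp. $\omega^*$-sum) if it is of the form $\sum_\omega L_i$ (resp. $\sum_{\omega^*}L_i$) for such a sequence. Every countable scattered linear order $L$ is a finite sum of elements of $\mathcal H$, and $m(L)$ denotes the least number of elements of $\mathcal H$ whose sum is $L$. If $m(L)=m$ and $L=L_0+\dots+L_{m-1}$ with $L_i\in\mathcal H$, then each $L_i$ is exactly one of: a singleton, an $\omega$-sum, an $\omega^*$-sum; moreover $L_i+L_{i+1}\notin\mathcal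 H$ for $i<m-1$, and if $|L_i|=1$ then $L_{i+1}$ is not an $\omega$-sum and $L_{i-1}$ is not an $\omega^*$-sum. A block of $L$ (w.r.t. this decomposition) is a sum of consecutive summands $B=L_i+L_{i+1}+\dots+L_{i+k}$, $k\ge 0$, satisfying one of: (A) $|L_j|=1$ for all $j\in\{i,\dots,i+k\}$, and ($i=0$ or $|L_{i-1}|=\omega$) and ($i+k=m-1$ or $|L_{i+k+1}|=\omega$); (B) every $L_j$, $j\in\{i,\dots,i+k\}$, is an $\omega$-sum, and ($i=0$ or ($L_{i-1}$ is an $\omega$-sum and $L_{i-2}$ is an $\omega^*$-sum)) and ($i+k=m-1$ or $L_{i+k+1}$ is not an $\omega$-sum); (C) every $L_j$, $j\in\{i,\dots,i+k\}$, is an $\omega^*$-sum, and ($i=0$ or $L_{i-1}$ is not an $\omega^*$-sum) and ($i+k=m-1$ or ($L_{i+k+1}$ is an $\omega^*$-sum and $L_{i+k+2}$ is an $\omega$-sum)); (D) $k=1$, $L_i$ is an $\omega^*$-sum and $L_{i+1}$ is an $\omega$-sum. $\mathrm{Block}(L)$ denotes the set of blocks; the blocks partition $L$ into convex parts. -}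

module Defs where

open import Level using (Lift; lift; 0ℓ) renaming (suc to lsuc)
open import Data.Nat using (ℕ; zero; suc; _+_; _∸_; _≤_; _<_)
open import Data.Product using (Σ; _×_; _,_; ∃)
open import Data.Sum using (_⊎_)
open import Data.Unit using (⊤)
open import Data.Empty using (⊥)
open import Relation.Nullary using (¬_)
open import Relation.Binary using (IsStrictTotalOrder)
open import Relation.Binary.PropositionalEquality using (_≡_; subst)
open import Function.Definitions using (Injective)
open import Function.Bundles using (_↔_)
import Data.Rational as Q

record Ord : Set₁ where
  constructor mkOrd
  field
    Car : Set
    lt  : Car → Car → Set
open Ord public

IsLinear : Ord → Set
IsLinear L = IsStrictTotalOrder (_≡_ {A = Car L}) (lt L)

record _↪_ (A B : Ord) : Set where
  field
    emb      : Car A → Car B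
    emb-inj  : Injective _≡_ _≡_ emb
    emb-pres : ∀ x y → lt A x y → lt B (emb x) (emb y)
    emb-refl : ∀ x y → lt B (emb x) (emb y) → lt A x y

record _≅_ (A B : Ord) : Set where
  field
    to      : Car A → Car B
    from    : Car B → Car A
    from-to : ∀ x → from (to x) ≡ x
    to-from : ∀ y → to (from y) ≡ y
    to-mono   : ∀ x y → lt A x y → lt B (to x) (to y)
    from-mono : ∀ x y → lt B x y → lt A (from x) (from y)

Countable : Ord → Set
Countable L = Σ (Car L → ℕ) λ f → Injective _≡_ _≡_ f

ℚOrd : Ord
ℚOrd = mkOrd Q.ℚ Q._<_

Scattered : Ord → Set
Scattered L = ¬ (ℚOrd ↪ L)

𝟙 : Ord
𝟙 = mkOrd ⊤ (λ _ _ → ⊥)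

Σω : (ℕ → Ord) → Ord
Σω Ls = mkOrd (Σ ℕ (λ i → Car (Ls i)))
  (λ { (i , x) (j , y) → i < j ⊎ Σ (i ≡ j) (λ e → lt (Ls j) (subst (λ k → Car (Ls k)) e x) y) })

Σω* : (ℕ → Ord) → Ord
Σω* Ls = mkOrd (Σ ℕ (λ i → Car (Ls i)))
  (λ { (i , x) (j , y) → j < i ⊎ Σ (i ≡ j) (λ e → lt (Ls j) (subst (λ k → Car (Ls k)) e x) y) })

FinSum : ℕ → (ℕ → Ord) → Ord
FinSum m Ls = mkOrd (Σ ℕ (λ i → i < m × Car (Ls i)))
  (λ { (i , _ , x) (j , _ , y) → i < j ⊎ Σ (i ≡ j) (λ e → lt (Ls j) (subst (λ k → Car (Ls k)) e x) y) })

-- for every i, the set {j | L_i ↪ L_j} is infinite (= unbounded in ℕ)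
HCond : (ℕ → Ord) → Set
HCond Ls = ∀ i k → Σ ℕ λ j → k ≤ j × (Ls i ↪ Ls j)

-- the class H (closed under isomorphism, i.e. a class of order types)
data IsH : Ord → Set₁ where
  h-one   : ∀ {L} → L ≅ 𝟙 → IsH L
  h-ω     : ∀ {L} (Ls : ℕ → Ord) → (∀ i → IsH (Ls i)) → HCond Ls → L ≅ Σω Ls → IsH L
  h-ω*    : ∀ {L} (Ls : ℕ → Ord) → (∀ i → IsH (Ls i)) → HCond Ls → L ≅ Σω* Ls → IsH L

IsωSum : Ord → Set₁
IsωSum L = Σ (ℕ → Ord) λ Ls → (∀ i → IsH (Ls i)) × HCond Ls × (L ≅ Σω Ls)

Isω*Sum : Ord → Set₁
Isω*Sum L = Σ (ℕ → Ord) λ Ls → (∀ i → IsH (Ls i)) × HCond Ls × (L ≅ Σω* Ls)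

IsSingleton : Ord → Set
IsSingleton L = Σ (Car L) λ c → ∀ x → x ≡ c

CardOmega : Ord → Set
CardOmega L = Car L ↔ ℕ

HDecomp : Ord → ℕ → Set₁
HDecomp L k = Σ (ℕ → Ord) λ Ls → (∀ i → i < k → IsH (Ls i)) × (L ≅ FinSum k Ls)

mIs : Ord → ℕ → Set₁
mIs L m = HDecomp L m × (∀ k → HDecomp L k → m ≤ k)

-- Blocks of a decomposition L_0 + ... + L_{m-1} (given as m and Ls).
-- A block L_i + ... + L_{i+k} is represented by the pair (i , k).

L1 : Set → Set₁
L1 A = Lift (lsuc 0ℓ) A

PrevA : (ℕ → Ord) → ℕ → Set
PrevA Ls zero    = ⊤
PrevA Ls (suc i) = CardOmega (Ls i)

PrevB : (ℕ → Ord) → ℕ → Set₁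
PrevB Ls zero          = L1 ⊤
PrevB Ls (suc zero)    = L1 ⊥
PrevB Ls (suc (suc i)) = IsωSum (Ls (suc i)) × Isω*Sum (Ls i)

PrevC : (ℕ → Ord) → ℕ → Set₁
PrevC Ls zero    = L1 ⊤
PrevC Ls (suc i) = ¬ Isω*Sum (Ls i)

BlockA BlockB BlockC BlockD : ℕ → (ℕ → Ord) → ℕ → ℕ → Set₁
BlockA m Ls i k =
  (∀ j → i ≤ j → j ≤ i + k → L1 (IsSingleton (Ls j)))
  × L1 (PrevA Ls i)
  × L1 (suc (i + k) ≡ m ⊎ CardOmega (Ls (suc (i + k))))
BlockB m Ls i k =
  (∀ j → i ≤ j → j ≤ i + k → IsωSum (Ls j))
  × PrevB Ls i
  × (L1 (suc (i + k) ≡ m) ⊎ (¬ IsωSum (Ls (suc (i + k)))))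
BlockC m Ls i k =
  (∀ j → i ≤ j → j ≤ i + k → Isω*Sum (Ls j))
  × PrevC Ls i
  × (L1 (suc (i + k) ≡ m)
     ⊎ (L1 (suc (suc (i + k)) < m) × Isω*Sum (Ls (suc (i + k))) × IsωSum (Ls (suc (suc (i + k))))))
BlockD m Ls i k =
  L1 (k ≡ 1) × Isω*Sum (Ls i) × IsωSum (Ls (suc i))

IsBlock : ℕ → (ℕ → Ord) → ℕ → ℕ → Set₁
IsBlock m Ls i k =
  L1 (i + k < m) × (BlockA m Ls i k ⊎ BlockB m Ls i k ⊎ BlockC m Ls i k ⊎ BlockD m Ls i k)

-- Blocks are defined by local conditions on consecutive summands.  Shifting
-- by n preserves the body, length and end conditions of a block; only the
-- conditions on the one or two summands preceding a block can look into B₀.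
-- So the proof consists of three ingredients:
--   * facts about the summands: ω-sums are countably infinite (a Cantor
--     pairing argument), no summand of a scattered order is both an ω-sum
--     and an ω*-sum (otherwise a Stern–Brocot embedding of ℚ exists), and by
--     minimality of m no singleton precedes an ω-sum (the two would merge
--     into a single ω-sum);
--   * uniqueness of the first block: every block starting inside B₀ is B₀;
--   * transport of blocks along the shift, where at the seam after B₀ the
--     conditions on preceding summands are checked case by case on B₀.
module Submission where

open import Defs
open import Level using (0ℓ; lift; lower)
open import Data.Nat using (ℕ; zero; suc; _+_; _*_; _∸_; _≤_; _<_; z≤n; s≤s; _≤?_; compare; less; equal; greater)
open import Data.Nat.Properties
open import Data.Nat.Solver using (module +-*-Solver)
open +-*-Solver using (solve; _:=_; _:+_; _:*_; con)
open import Data.Integer using (-[1+_]; +<+; -<-)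
import Data.Integer as ℤ
open import Data.Rational using (ℚ; mkℚ)
import Data.Rational as ℚ
import Data.Rational.Properties as ℚ
open import Data.Product using (Σ; _×_; _,_; proj₁; proj₂)
open import Data.Sum as Sum using (_⊎_; inj₁; inj₂; [_,_])
open import Data.Unit using (⊤; tt)
open import Data.Empty using (⊥; ⊥-elim)
open import Data.List using (List; []; _∷_)
open import Function using (_∘_)
open import Function.Bundles using (_↔_; mk↔ₛ′; Inverse)
open import Function.Properties.Inverse using (↔-refl; ↔-sym; ↔-trans)
open import Function.Related.TypeIsomorphisms
  using (×-distribˡ-⊎; ×-distribʳ-⊎; ⊎-assoc; ⊎-comm; Σ-assoc; Σ-distribˡ-⊎)
open import Data.Sum.Function.Propositional using (_⊎-↔_)
open import Data.Product.Function.NonDependent.Propositional using (_×-↔_)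
open import Data.Product.Function.Dependent.Propositional using (Σ-↔)
open import Relation.Nullary using (¬_; yes; no)
open import Relation.Binary using (IsStrictTotalOrder; tri<; tri≈; tri>)
open import Relation.Binary.PropositionalEquality hiding ([_])

≅-refl : ∀ {A} → A ≅ A
≅-refl = record { to = λ x → x ; from = λ x → x ; from-to = λ _ → refl ; to-from = λ _ → refl
                ; to-mono = λ _ _ p → p ; from-mono = λ _ _ p → p }

≅-sym : ∀ {A B} → A ≅ B → B ≅ A
≅-sym i = record { to = from ; from = to ; from-to = to-from ; to-from = from-to
                 ; to-mono = from-mono ; from-mono = to-mono }
  where open _≅_ i

infixr 4 _⨾_
_⨾_ : ∀ {A B C} → A ≅ B → B ≅ C → A ≅ C
i ⨾ j = record
  { to = λ x → J.to (I.to x) ; from = λ z → I.from (J.from z)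
  ; from-to = λ x → trans (cong I.from (J.from-to (I.to x))) (I.from-to x)
  ; to-from = λ z → trans (cong J.to (I.to-from (J.from z))) (J.to-from z)
  ; to-mono = λ a b p → J.to-mono _ _ (I.to-mono a b p)
  ; from-mono = λ a b p → I.from-mono _ _ (J.from-mono a b p) }
  where
  module I = _≅_ i
  module J = _≅_ j

≅⇒↔ : ∀ {A B} → A ≅ B → Car A ↔ Car B
≅⇒↔ i = mk↔ₛ′ to from to-from from-to
  where open _≅_ i

⊕lt : (A B : Ord) → Car A ⊎ Car B → Car A ⊎ Car B → Set
⊕lt A B (inj₁ x) (inj₁ y) = lt A x y
⊕lt A B (inj₁ x) (inj₂ y) = ⊤
⊕lt A B (inj₂ x) (inj₁ y) = ⊥
⊕lt A B (inj₂ x) (inj₂ y) = lt B x y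

_⊕_ : Ord → Ord → Ord
A ⊕ B = mkOrd (Car A ⊎ Car B) (⊕lt A B)

⊕-cong : ∀ {A A′ B B′} → A ≅ A′ → B ≅ B′ → (A ⊕ B) ≅ (A′ ⊕ B′)
⊕-cong {A} {A′} {B} {B′} i j = record
  { to = Sum.map I.to J.to ; from = Sum.map I.from J.from
  ; from-to = [ cong inj₁ ∘ I.from-to , cong inj₂ ∘ J.from-to ]
  ; to-from = [ cong inj₁ ∘ I.to-from , cong inj₂ ∘ J.to-from ]
  ; to-mono = mono I.to-mono J.to-mono ; from-mono = mono I.from-mono J.from-mono }
  where
  module I = _≅_ i
  module J = _≅_ j
  mono : ∀ {C C′ D D′} {f : Car C → Car C′} {g : Car D → Car D′}
    → (∀ x y → lt C x y → lt C′ (f x) (f y)) → (∀ x y → lt D x y → lt D′ (g x) (g y))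
    → ∀ x y → ⊕lt C D x y → ⊕lt C′ D′ (Sum.map f g x) (Sum.map f g y)
  mono fm gm (inj₁ x) (inj₁ y) p = fm x y p
  mono fm gm (inj₁ x) (inj₂ y) p = tt
  mono fm gm (inj₂ x) (inj₂ y) p = gm x y p

⊕-assoc : ∀ {A B C} → (A ⊕ (B ⊕ C)) ≅ ((A ⊕ B) ⊕ C)
⊕-assoc {A} {B} {C} = record
  { to = t ; from = f ; from-to = ft ; to-from = tf ; to-mono = tm ; from-mono = fm }
  where
  t : Car (A ⊕ (B ⊕ C)) → Car ((A ⊕ B) ⊕ C)
  t (inj₁ x) = inj₁ (inj₁ x)
  t (inj₂ (inj₁ x)) = inj₁ (inj₂ x)
  t (inj₂ (inj₂ x)) = inj₂ x
  f : Car ((A ⊕ B) ⊕ C) → Car (A ⊕ (B ⊕ C))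
  f (inj₁ (inj₁ x)) = inj₁ x
  f (inj₁ (inj₂ x)) = inj₂ (inj₁ x)
  f (inj₂ x) = inj₂ (inj₂ x)
  ft : ∀ x → f (t x) ≡ x
  ft (inj₁ x) = refl
  ft (inj₂ (inj₁ x)) = refl
  ft (inj₂ (inj₂ x)) = refl
  tf : ∀ x → t (f x) ≡ x
  tf (inj₁ (inj₁ x)) = refl
  tf (inj₁ (inj₂ x)) = refl
  tf (inj₂ x) = refl
  tm : ∀ x y → lt (A ⊕ (B ⊕ C)) x y → lt ((A ⊕ B) ⊕ C) (t x) (t y)
  tm (inj₁ x) (inj₁ y) p = p
  tm (inj₁ x) (inj₂ (inj₁ y)) p = tt
  tm (inj₁ x) (inj₂ (inj₂ y)) p = tt
  tm (inj₂ (inj₁ x)) (inj₂ (inj₁ y)) p = p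
  tm (inj₂ (inj₁ x)) (inj₂ (inj₂ y)) p = tt
  tm (inj₂ (inj₂ x)) (inj₂ (inj₂ y)) p = p
  fm : ∀ x y → lt ((A ⊕ B) ⊕ C) x y → lt (A ⊕ (B ⊕ C)) (f x) (f y)
  fm (inj₁ (inj₁ x)) (inj₁ (inj₁ y)) p = p
  fm (inj₁ (inj₁ x)) (inj₁ (inj₂ y)) p = tt
  fm (inj₁ (inj₂ x)) (inj₁ (inj₂ y)) p = p
  fm (inj₁ (inj₁ x)) (inj₂ y) p = tt
  fm (inj₁ (inj₂ x)) (inj₂ y) p = tt
  fm (inj₂ x) (inj₂ y) p = p

FinSum-uncons : ∀ m (Ls : ℕ → Ord) → FinSum (suc m) Ls ≅ (Ls 0 ⊕ FinSum m (Ls ∘ suc))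
FinSum-uncons m Ls = record
  { to = t ; from = f ; from-to = ft ; to-from = tf ; to-mono = tm ; from-mono = fm }
  where
  t : Car (FinSum (suc m) Ls) → Car (Ls 0 ⊕ FinSum m (Ls ∘ suc))
  t (zero , p , x) = inj₁ x
  t (suc i , s≤s p , x) = inj₂ (i , p , x)
  f : Car (Ls 0 ⊕ FinSum m (Ls ∘ suc)) → Car (FinSum (suc m) Ls)
  f (inj₁ x) = zero , s≤s z≤n , x
  f (inj₂ (i , p , x)) = suc i , s≤s p , x
  ft : ∀ x → f (t x) ≡ x
  ft (zero , p , x) = cong (λ q → zero , q , x) (≤-irrelevant _ _)
  ft (suc i , s≤s p , x) = refl
  tf : ∀ x → t (f x) ≡ x
  tf (inj₁ x) = refl
  tf (inj₂ (i , p , x)) = refl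
  tm : ∀ x y → lt (FinSum (suc m) Ls) x y → lt (Ls 0 ⊕ FinSum m (Ls ∘ suc)) (t x) (t y)
  tm (zero , p , x) (zero , q , y) (inj₂ (refl , r)) = r
  tm (zero , p , x) (suc j , s≤s q , y) r = tt
  tm (suc i , s≤s p , x) (zero , q , y) (inj₂ (() , r))
  tm (suc i , s≤s p , x) (suc j , s≤s q , y) (inj₁ (s≤s r)) = inj₁ r
  tm (suc i , s≤s p , x) (suc .i , s≤s q , y) (inj₂ (refl , r)) = inj₂ (refl , r)
  fm : ∀ x y → lt (Ls 0 ⊕ FinSum m (Ls ∘ suc)) x y → lt (FinSum (suc m) Ls) (f x) (f y)
  fm (inj₁ x) (inj₁ y) r = inj₂ (refl , r)
  fm (inj₁ x) (inj₂ (j , q , y)) r = inj₁ (s≤s z≤n)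
  fm (inj₂ (i , p , x)) (inj₂ (j , q , y)) (inj₁ r) = inj₁ (s≤s r)
  fm (inj₂ (i , p , x)) (inj₂ (.i , q , y)) (inj₂ (refl , r)) = inj₂ (refl , r)

_∷ₒ_ : Ord → (ℕ → Ord) → ℕ → Ord
(A ∷ₒ As) zero = A
(A ∷ₒ As) (suc k) = As k

⊕-Σω : ∀ {A} {As : ℕ → Ord} → (A ⊕ Σω As) ≅ Σω (A ∷ₒ As)
⊕-Σω {A} {As} = record
  { to = t ; from = f ; from-to = ft ; to-from = tf ; to-mono = tm ; from-mono = fm }
  where
  t : Car (A ⊕ Σω As) → Car (Σω (A ∷ₒ As))
  t (inj₁ x) = zero , x
  t (inj₂ (k , a)) = suc k , a
  f : Car (Σω (A ∷ₒ As)) → Car (A ⊕ Σω As)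
  f (zero , x) = inj₁ x
  f (suc k , a) = inj₂ (k , a)
  ft : ∀ x → f (t x) ≡ x
  ft (inj₁ x) = refl
  ft (inj₂ (k , a)) = refl
  tf : ∀ x → t (f x) ≡ x
  tf (zero , x) = refl
  tf (suc k , a) = refl
  tm : ∀ x y → lt (A ⊕ Σω As) x y → lt (Σω (A ∷ₒ As)) (t x) (t y)
  tm (inj₁ x) (inj₁ y) p = inj₂ (refl , p)
  tm (inj₁ x) (inj₂ (k , b)) p = inj₁ (s≤s z≤n)
  tm (inj₂ (k , a)) (inj₂ (k′ , b)) (inj₁ p) = inj₁ (s≤s p)
  tm (inj₂ (k , a)) (inj₂ (.k , b)) (inj₂ (refl , p)) = inj₂ (refl , p)
  fm : ∀ x y → lt (Σω (A ∷ₒ As)) x y → lt (A ⊕ Σω As) (f x) (f y)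
  fm (zero , x) (zero , y) (inj₂ (refl , p)) = p
  fm (zero , x) (suc k , y) p = tt
  fm (suc k , x) (zero , y) (inj₂ (() , p))
  fm (suc k , x) (suc k′ , y) (inj₁ (s≤s p)) = inj₁ p
  fm (suc k , x) (suc .k , y) (inj₂ (refl , p)) = inj₂ (refl , p)

-- Every order in H is nonempty: descend through first summands to a singleton.
H-point : ∀ {A} → IsH A → Car A
H-point (h-one i) = _≅_.from i tt
H-point (h-ω As hs _ i) = _≅_.from i (0 , H-point (hs 0))
H-point (h-ω* As hs _ i) = _≅_.from i (0 , H-point (hs 0))

-- Comparing a point of an ω-sum or ω*-sum with itself: both orders unfold to
-- this type, which is empty when the summands are irreflexive.
sum-irrefl : (As : ℕ → Ord) → (∀ j y → ¬ lt (As j) y y)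
  → ∀ j y → ¬ (j < j ⊎ Σ (j ≡ j) (λ e → lt (As j) (subst (λ k → Car (As k)) e y) y))
sum-irrefl As irr j y (inj₁ j<j) = <-irrefl refl j<j
sum-irrefl As irr j y (inj₂ (refl , q)) = irr j y q

H-irrefl : ∀ {A} → IsH A → ∀ x → ¬ lt A x x
H-irrefl (h-one i) x p = _≅_.to-mono i x x p
H-irrefl (h-ω As hs _ i) x p = sum-irrefl As (H-irrefl ∘ hs) _ _ (_≅_.to-mono i x x p)
H-irrefl (h-ω* As hs _ i) x p = sum-irrefl As (H-irrefl ∘ hs) _ _ (_≅_.to-mono i x x p)

singleton↪ : ∀ {A B} → IsH A → IsH B → IsSingleton A → A ↪ B
singleton↪ {A} {B} hA hB (c , all) = record
  { emb = λ _ → H-point hB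
  ; emb-inj = λ {x} {y} _ → trans (all x) (sym (all y))
  ; emb-pres = λ x y p → ⊥-elim (H-irrefl hA c (subst₂ (lt A) (all x) (all y) p))
  ; emb-refl = λ x y p → ⊥-elim (H-irrefl hB _ p) }

not-singleton : ∀ {X : Ord} {B : Set} (g : B → Car X) (h : Car X → B)
  → (∀ b → h (g b) ≡ b) → ∀ {b c} → b ≢ c → ¬ IsSingleton X
not-singleton g h hg {b} {c} b≢c (_ , all) =
  b≢c (trans (sym (hg b)) (trans (cong h (trans (all (g b)) (sym (all (g c))))) (hg c)))

-- ω-sums, ω*-sums and countably infinite orders are not singletons: the
-- points (0 , _) and (1 , _) of a sum, resp. 0 and 1, are distinct.
ωSum-not-singleton : ∀ {X} → IsωSum X → ¬ IsSingleton X
ωSum-not-singleton {X} (As , hs , _ , i) =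
  not-singleton {X} from to to-from {0 , H-point (hs 0)} {1 , H-point (hs 1)} (0≢1+n ∘ cong proj₁)
  where open _≅_ i

ω*Sum-not-singleton : ∀ {X} → Isω*Sum X → ¬ IsSingleton X
ω*Sum-not-singleton {X} (As , hs , _ , i) =
  not-singleton {X} from to to-from {0 , H-point (hs 0)} {1 , H-point (hs 1)} (0≢1+n ∘ cong proj₁)
  where open _≅_ i

countable-not-singleton : ∀ {X} → CardOmega X → ¬ IsSingleton X
countable-not-singleton {X} f = not-singleton {X} from to strictlyInverseˡ {0} {1} 0≢1+n
  where open Inverse f

-- Minimality of the decomposition: in a decomposition with the least possible
-- number of summands, a singleton is never followed by an ω-sum, since
-- 1 + Σω As = Σω (1 ∷ As) would be a decomposition with one summand less.

-- Replace the summands Lⱼ, Lⱼ₊₁ ≅ Σω As by the single summand Σω (Lⱼ ∷ As).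
merge : ℕ → (ℕ → Ord) → (ℕ → Ord) → ℕ → Ord
merge zero Ls As zero = Σω (Ls 0 ∷ₒ As)
merge zero Ls As (suc i) = Ls (suc (suc i))
merge (suc j) Ls As zero = Ls 0
merge (suc j) Ls As (suc i) = merge j (Ls ∘ suc) As i

merge-≅ : ∀ j m Ls As → Ls (suc j) ≅ Σω As
  → FinSum (suc (suc (j + m))) Ls ≅ FinSum (suc (j + m)) (merge j Ls As)
merge-≅ zero m Ls As ψ =
  FinSum-uncons (suc m) Ls ⨾ ⊕-cong ≅-refl (FinSum-uncons m (Ls ∘ suc)) ⨾ ⊕-assoc
  ⨾ ⊕-cong (⊕-cong ≅-refl ψ ⨾ ⊕-Σω) ≅-refl ⨾ ≅-sym (FinSum-uncons m (merge 0 Ls As))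
merge-≅ (suc j) m Ls As ψ =
  FinSum-uncons (suc (suc (j + m))) Ls ⨾ ⊕-cong ≅-refl (merge-≅ j m (Ls ∘ suc) As ψ)
  ⨾ ≅-sym (FinSum-uncons (suc (j + m)) (merge (suc j) Ls As))

-- If Lⱼ is a singleton, the merged summand Σω (Lⱼ ∷ As) is again in H: the
-- singleton embeds into every later summand, so the H-condition persists.
merge-H : ∀ j m Ls As → (∀ i → i < suc (suc (j + m)) → IsH (Ls i))
  → (∀ k → IsH (As k)) → HCond As → IsSingleton (Ls j)
  → ∀ i → i < suc (j + m) → IsH (merge j Ls As i)
merge-H zero m Ls As hL hA hc s zero _ = h-ω (Ls 0 ∷ₒ As) hB hcB ≅-refl
  where
  hB : ∀ i → IsH ((Ls 0 ∷ₒ As) i)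
  hB zero = hL 0 (s≤s z≤n)
  hB (suc k) = hA k
  hcB : HCond (Ls 0 ∷ₒ As)
  hcB zero k = suc k , n≤1+n k , singleton↪ (hL 0 (s≤s z≤n)) (hA k) s
  hcB (suc i) k with hc i k
  ... | j′ , k≤j′ , e = suc j′ , m≤n⇒m≤1+n k≤j′ , e
merge-H zero m Ls As hL hA hc s (suc i) (s≤s p) = hL (suc (suc i)) (s≤s (s≤s p))
merge-H (suc j) m Ls As hL hA hc s zero _ = hL 0 (s≤s z≤n)
merge-H (suc j) m Ls As hL hA hc s (suc i) (s≤s p) =
  merge-H j m (Ls ∘ suc) As (λ i q → hL (suc i) (s≤s q)) hA hc s i p

singleton-before-ωSum : ∀ {L m Ls} → mIs L m → L ≅ FinSum m Ls → (∀ i → i < m → IsH (Ls i))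
  → ∀ j → suc j < m → IsSingleton (Ls j) → ¬ IsωSum (Ls (suc j))
singleton-before-ωSum {L} {m} {Ls} (_ , least) iso hL j j+1<m s (As , hA , hc , ψ)
  with m≤n⇒∃[o]m+o≡n j+1<m
... | m′ , refl =
  <-irrefl refl (least _ (merge j Ls As , merge-H j m′ Ls As hL hA hc s , iso ⨾ merge-≅ j m′ Ls As ψ))

-- Cardinality: as a set, every order in H is a singleton or countably
-- infinite; hence every ω-sum is countably infinite.  The bijections are
-- assembled from the Cantor pairing ℕ × ℕ ↔ ℕ and the standard algebraic
-- laws of _×_ and _⊎_ up to ↔.

infixr 5 _⟫_
_⟫_ : ∀ {A B C : Set} → A ↔ B → B ↔ C → A ↔ C
_⟫_ = ↔-trans

-- Cantor pairing: (i , j) ↦ Tri (i + j) + i enumerates the diagonals i + j = s.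
Tri : ℕ → ℕ
Tri zero = 0
Tri (suc s) = suc s + Tri s

pair : ℕ × ℕ → ℕ
pair (i , j) = Tri (i + j) + i

next : ℕ × ℕ → ℕ × ℕ
next (i , suc j) = (suc i , j)
next (i , zero) = (0 , suc i)

unpair : ℕ → ℕ × ℕ
unpair zero = (0 , 0)
unpair (suc n) = next (unpair n)

pair-next : ∀ x → pair (next x) ≡ suc (pair x)
pair-next (i , suc j) = begin
    Tri (suc i + j) + suc i   ≡⟨ cong (λ t → Tri t + suc i) (sym (+-suc i j)) ⟩
    Tri (i + suc j) + suc i   ≡⟨ +-suc _ i ⟩
    suc (Tri (i + suc j) + i) ∎
  where open ≡-Reasoning
pair-next (i , zero) = begin
    suc i + Tri i + 0     ≡⟨ +-identityʳ _ ⟩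
    suc (i + Tri i)       ≡⟨ cong suc (+-comm i (Tri i)) ⟩
    suc (Tri i + i)       ≡⟨ cong (λ t → suc (Tri t + i)) (sym (+-identityʳ i)) ⟩
    suc (Tri (i + 0) + i) ∎
  where open ≡-Reasoning

pair-unpair : ∀ n → pair (unpair n) ≡ n
pair-unpair zero = refl
pair-unpair (suc n) = trans (pair-next (unpair n)) (cong suc (pair-unpair n))

next-onto : ∀ x → x ≡ (0 , 0) ⊎ Σ (ℕ × ℕ) (λ y → next y ≡ x)
next-onto (zero , zero) = inj₁ refl
next-onto (suc i , j) = inj₂ ((i , suc j) , refl)
next-onto (zero , suc i) = inj₂ ((i , zero) , refl)

unpair-pair : ∀ n x → pair x ≡ n → unpair n ≡ x
unpair-pair n x e with next-onto x
unpair-pair zero .(0 , 0) e | inj₁ refl = refl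
unpair-pair (suc n) .(0 , 0) () | inj₁ refl
unpair-pair zero .(next y) e | inj₂ (y , refl) = ⊥-elim (0≢1+n (trans (sym e) (pair-next y)))
unpair-pair (suc n) .(next y) e | inj₂ (y , refl) =
  cong next (unpair-pair n y (suc-injective (trans (sym (pair-next y)) e)))

ℕ×ℕ↔ℕ : (ℕ × ℕ) ↔ ℕ
ℕ×ℕ↔ℕ = mk↔ₛ′ pair unpair pair-unpair (λ x → unpair-pair (pair x) x refl)

ℕ↔⊤⊎ℕ : ℕ ↔ (⊤ ⊎ ℕ)
ℕ↔⊤⊎ℕ = mk↔ₛ′ t f tf ft
  where
  t : ℕ → ⊤ ⊎ ℕ
  t zero = inj₁ tt
  t (suc n) = inj₂ n
  f : ⊤ ⊎ ℕ → ℕ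
  f = [ (λ _ → zero) , suc ]
  tf : ∀ y → t (f y) ≡ y
  tf (inj₁ tt) = refl
  tf (inj₂ n) = refl
  ft : ∀ x → f (t x) ≡ x
  ft zero = refl
  ft (suc n) = refl

ℕ⊎ℕ↔ℕ : (ℕ ⊎ ℕ) ↔ ℕ
ℕ⊎ℕ↔ℕ = mk↔ₛ′ t f tf ft
  where
  t : ℕ ⊎ ℕ → ℕ
  t (inj₁ n) = n + n
  t (inj₂ n) = suc (n + n)
  step : ℕ ⊎ ℕ → ℕ ⊎ ℕ
  step = Sum.map suc suc
  f : ℕ → ℕ ⊎ ℕ
  f zero = inj₁ 0
  f (suc zero) = inj₂ 0
  f (suc (suc n)) = step (f n)
  t-step : ∀ y → t (step y) ≡ suc (suc (t y))
  t-step (inj₁ n) = cong suc (+-suc n n)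
  t-step (inj₂ n) = cong (suc ∘ suc) (+-suc n n)
  tf : ∀ y → t (f y) ≡ y
  tf zero = refl
  tf (suc zero) = refl
  tf (suc (suc n)) = trans (t-step (f n)) (cong (suc ∘ suc) (tf n))
  f-double : ∀ n → f (n + n) ≡ inj₁ n
  f-double zero = refl
  f-double (suc n) = trans (cong f (+-suc (suc n) n)) (cong step (f-double n))
  ft : ∀ x → f (t x) ≡ x
  ft (inj₁ n) = f-double n
  ft (inj₂ zero) = refl
  ft (inj₂ (suc n)) = trans (cong (f ∘ suc) (+-suc (suc n) n)) (cong step (ft (inj₂ n)))

-- If ℕ splits into parts S and R, then ℕ ⊎ (S × ℕ) ↔ ℕ: replace ℕ by
-- (S ⊎ R) × ℕ, merge the two copies of S × ℕ, and reassemble (S ⊎ R) × ℕ.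
absorb : ∀ {S R : Set} → ℕ ↔ (S ⊎ R) → (ℕ ⊎ (S × ℕ)) ↔ ℕ
absorb {S} {R} split =
     (↔-sym ℕ×ℕ↔ℕ ⊎-↔ ↔-refl)
  ⟫ ((split ×-↔ ↔-refl) ⊎-↔ ↔-refl)
  ⟫ (×-distribʳ-⊎ ⊎-↔ ↔-refl)
  ⟫ ⊎-assoc 0ℓ (S × ℕ) (R × ℕ) (S × ℕ)
  ⟫ (↔-refl ⊎-↔ ⊎-comm (R × ℕ) (S × ℕ))
  ⟫ ↔-sym (⊎-assoc 0ℓ (S × ℕ) (S × ℕ) (R × ℕ))
  ⟫ (↔-sym ×-distribˡ-⊎ ⊎-↔ ↔-refl)
  ⟫ ((↔-refl ×-↔ ℕ⊎ℕ↔ℕ) ⊎-↔ ↔-refl)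
  ⟫ ↔-sym ×-distribʳ-⊎
  ⟫ (↔-sym split ×-↔ ↔-refl)
  ⟫ ℕ×ℕ↔ℕ

Small : Set → Set
Small A = (A ↔ ⊤) ⊎ (A ↔ ℕ)

-- For a small set A, Infinite r is inhabited iff A is infinite and Finite r
-- iff A is a singleton; they decompose A as ⊤ ⊎ (Infinite r × ℕ) and split ⊤.
Infinite Finite : ∀ {A} → Small A → Set
Infinite (inj₁ _) = ⊥
Infinite (inj₂ _) = ⊤
Finite (inj₁ _) = ⊤
Finite (inj₂ _) = ⊥

small-shape : ∀ {A} (r : Small A) → A ↔ (⊤ ⊎ (Infinite r × ℕ))
small-shape (inj₁ f) =
  f ⟫ mk↔ₛ′ inj₁ [ (λ _ → tt) , (λ ()) ] (λ { (inj₁ tt) → refl ; (inj₂ (() , _)) }) (λ _ → refl)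
small-shape (inj₂ f) = f ⟫ ℕ↔⊤⊎ℕ ⟫ (↔-refl ⊎-↔ mk↔ₛ′ (tt ,_) proj₂ (λ _ → refl) (λ _ → refl))

small-split : ∀ {A} (r : Small A) → ⊤ ↔ (Infinite r ⊎ Finite r)
small-split (inj₁ _) = mk↔ₛ′ inj₂ (λ _ → tt) (λ { (inj₁ ()) ; (inj₂ tt) → refl }) (λ _ → refl)
small-split (inj₂ _) = mk↔ₛ′ inj₁ (λ _ → tt) (λ { (inj₁ tt) → refl ; (inj₂ ()) }) (λ _ → refl)

-- An ℕ-indexed disjoint union of small sets is countably infinite: it is
-- ℕ ⊎ (S × ℕ) for the set S of indices of infinite summands.
Σ-small : (As : ℕ → Set) → (∀ i → Small (As i)) → Σ ℕ As ↔ ℕ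
Σ-small As r =
     Σ-↔ ↔-refl (λ {i} → small-shape (r i))
  ⟫ Σ-distribˡ-⊎
  ⟫ (ℕ×⊤↔ℕ ⊎-↔ ↔-sym Σ-assoc)
  ⟫ absorb (↔-sym ℕ×⊤↔ℕ ⟫ Σ-↔ ↔-refl (λ {i} → small-split (r i)) ⟫ Σ-distribˡ-⊎)
  where
  ℕ×⊤↔ℕ : Σ ℕ (λ _ → ⊤) ↔ ℕ
  ℕ×⊤↔ℕ = mk↔ₛ′ proj₁ (_, tt) (λ _ → refl) (λ _ → refl)

H-small : ∀ {A} → IsH A → Small (Car A)
H-small (h-one i) = inj₁ (≅⇒↔ i)
H-small (h-ω As hs _ i) = inj₂ (≅⇒↔ i ⟫ Σ-small (Car ∘ As) (H-small ∘ hs))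
H-small (h-ω* As hs _ i) = inj₂ (≅⇒↔ i ⟫ Σ-small (Car ∘ As) (H-small ∘ hs))

ωSum-countable : ∀ {X} → IsωSum X → CardOmega X
ωSum-countable (As , hs , _ , i) = ≅⇒↔ i ⟫ Σ-small (Car ∘ As) (H-small ∘ hs)

-- Scatteredness: inside a scattered linear order no summand is both an
-- ω-sum and an ω*-sum.  Such an order X has a self-embedding pushing
-- everything below a point x (through the ω*-sum) and one pushing
-- everything above x (through the ω-sum); iterating them along finite
-- left/right words embeds the infinite binary tree, in its in-order, into X,
-- and the Stern–Brocot coding embeds ℚ into that tree.

-- Paths in the infinite binary tree, ordered in-order (left subtree, node,
-- right subtree).
data Turn : Set where
  left right : Turn

Path : Set
Path = List Turn

data _◁_ : Path → Path → Set where
  left◁root   : ∀ {w} → (left ∷ w) ◁ []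
  root◁right  : ∀ {w} → [] ◁ (right ∷ w)
  left◁right  : ∀ {w v} → (left ∷ w) ◁ (right ∷ v)
  inside-left  : ∀ {w v} → w ◁ v → (left ∷ w) ◁ (left ∷ v)
  inside-right : ∀ {w v} → w ◁ v → (right ∷ w) ◁ (right ∷ v)

mirror : Path → Path
mirror [] = []
mirror (left ∷ w) = right ∷ mirror w
mirror (right ∷ w) = left ∷ mirror w

mirror-◁ : ∀ {w v} → w ◁ v → mirror v ◁ mirror w
mirror-◁ left◁root = root◁right
mirror-◁ root◁right = left◁root
mirror-◁ left◁right = left◁right
mirror-◁ (inside-left p) = inside-right (mirror-◁ p)
mirror-◁ (inside-right p) = inside-left (mirror-◁ p)

-- The Stern–Brocot path of the positive fraction (a+1)/(b+1), computed with
-- fuel f (enough when a + b < f): below 1 descend left to a/(b−a), above 1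
-- descend right to (a−b)/b.
stern-brocot : (f a b : ℕ) → Path
stern-brocot zero a b = []
stern-brocot (suc f) a b with compare a b
... | less .a c = left ∷ stern-brocot f a c
... | equal .a = []
... | greater .b c = right ∷ stern-brocot f c b

cross-impossible : ∀ P Q R S → Q ≤ P → R ≤ S → ¬ (P * S < R * Q)
cross-impossible P Q R S q≤p r≤s h = <⇒≱ h (begin
  R * Q ≤⟨ *-mono-≤ r≤s q≤p ⟩
  S * P ≡⟨ *-comm S P ⟩
  P * S ∎)
  where open ≤-Reasoning

cross-left : ∀ a c x y → suc a * suc (suc (c + y)) < suc c * suc (suc (a + x))
  → suc a * suc y < suc c * suc x
cross-left a c x y h = +-cancelˡ-< (suc a * suc c) _ _ (subst₂ _<_ e₁ e₂ h)
  where
  e₁ : suc a * suc (suc (c + y)) ≡ suc a * suc c + suc a * suc y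
  e₁ = solve 3 (λ a c y → (con 1 :+ a) :* (con 2 :+ (c :+ y))
         := (con 1 :+ a) :* (con 1 :+ c) :+ (con 1 :+ a) :* (con 1 :+ y)) refl a c y
  e₂ : suc c * suc (suc (a + x)) ≡ suc a * suc c + suc c * suc x
  e₂ = solve 3 (λ a c x → (con 1 :+ c) :* (con 2 :+ (a :+ x))
         := (con 1 :+ a) :* (con 1 :+ c) :+ (con 1 :+ c) :* (con 1 :+ x)) refl a c x

cross-right : ∀ b d x y → suc (suc (b + x)) * suc d < suc (suc (d + y)) * suc b
  → suc x * suc d < suc y * suc b
cross-right b d x y h = +-cancelˡ-< (suc b * suc d) _ _ (subst₂ _<_ e₁ e₂ h)
  where
  e₁ : suc (suc (b + x)) * suc d ≡ suc b * suc d + suc x * suc d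
  e₁ = solve 3 (λ b d x → (con 2 :+ (b :+ x)) :* (con 1 :+ d)
         := (con 1 :+ b) :* (con 1 :+ d) :+ (con 1 :+ x) :* (con 1 :+ d)) refl b d x
  e₂ : suc (suc (d + y)) * suc b ≡ suc b * suc d + suc y * suc b
  e₂ = solve 3 (λ b d y → (con 2 :+ (d :+ y)) :* (con 1 :+ b)
         := (con 1 :+ b) :* (con 1 :+ d) :+ (con 1 :+ y) :* (con 1 :+ b)) refl b d y

fuel-left : ∀ a x f → a + suc (a + x) < suc f → a + x < f
fuel-left a x f h = ≤-trans (m≤n+m (suc (a + x)) a) (≤-pred h)

fuel-right : ∀ b x f → suc (b + x) + b < suc f → x + b < f
fuel-right b x f h = ≤-trans (≤-trans (s≤s (≤-reflexive (+-comm x b))) (m≤m+n (suc (b + x)) b)) (≤-pred h)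

stern-brocot-mono : ∀ f₁ f₂ a b c d → a + b < f₁ → c + d < f₂
  → suc a * suc d < suc c * suc b → stern-brocot f₁ a b ◁ stern-brocot f₂ c d
stern-brocot-mono (suc f₁) (suc f₂) a b c d h₁ h₂ h with compare a b | compare c d
... | less .a x | less .c y =
  inside-left (stern-brocot-mono f₁ f₂ a x c y (fuel-left a x f₁ h₁) (fuel-left c y f₂ h₂) (cross-left a c x y h))
... | less .a x | equal .c = left◁root
... | less .a x | greater .d y = left◁right
... | equal .a | less .c y =
  ⊥-elim (cross-impossible (suc a) (suc a) (suc c) (suc (suc (c + y))) ≤-refl (s≤s (m≤n⇒m≤1+n (m≤m+n c y))) h)
... | equal .a | equal .c = ⊥-elim (cross-impossible (suc a) (suc a) (suc c) (suc c) ≤-refl ≤-refl h)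
... | equal .a | greater .d y = root◁right
... | greater .b x | less .c y =
  ⊥-elim (cross-impossible (suc (suc (b + x))) (suc b) (suc c) (suc (suc (c + y)))
    (s≤s (m≤n⇒m≤1+n (m≤m+n b x))) (s≤s (m≤n⇒m≤1+n (m≤m+n c y))) h)
... | greater .b x | equal .c =
  ⊥-elim (cross-impossible (suc (suc (b + x))) (suc b) (suc c) (suc c) (s≤s (m≤n⇒m≤1+n (m≤m+n b x))) ≤-refl h)
... | greater .b x | greater .d y =
  inside-right (stern-brocot-mono f₁ f₂ x b y d (fuel-right b x f₁ h₁) (fuel-right d y f₂ h₂) (cross-right b d x y h))

positive-path : ℕ → ℕ → Path
positive-path a b = stern-brocot (suc (a + b)) a b

-- The coding of ℚ: 0 is the root, positive rationals go right, negative
-- rationals are mirrored to the left.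
ℚ-path : ℚ → Path
ℚ-path (mkℚ (ℤ.+ zero) d _) = []
ℚ-path (mkℚ (ℤ.+ suc a) d _) = right ∷ positive-path a d
ℚ-path (mkℚ -[1+ a ] d _) = left ∷ mirror (positive-path a d)

ℚ-path-mono : ∀ p q → p ℚ.< q → ℚ-path p ◁ ℚ-path q
ℚ-path-mono (mkℚ (ℤ.+ zero) b _) (mkℚ (ℤ.+ zero) d _) (ℚ.*<* (+<+ ()))
ℚ-path-mono (mkℚ (ℤ.+ zero) b _) (mkℚ (ℤ.+ suc c) d _) h = root◁right
ℚ-path-mono (mkℚ (ℤ.+ zero) b _) (mkℚ -[1+ c ] d _) (ℚ.*<* ())
ℚ-path-mono (mkℚ (ℤ.+ suc a) b _) (mkℚ (ℤ.+ zero) d _) (ℚ.*<* (+<+ ()))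
ℚ-path-mono (mkℚ (ℤ.+ suc a) b _) (mkℚ (ℤ.+ suc c) d _) (ℚ.*<* (+<+ h)) =
  inside-right (stern-brocot-mono _ _ a b c d ≤-refl ≤-refl h)
ℚ-path-mono (mkℚ (ℤ.+ suc a) b _) (mkℚ -[1+ c ] d _) (ℚ.*<* ())
ℚ-path-mono (mkℚ -[1+ a ] b _) (mkℚ (ℤ.+ zero) d _) h = left◁root
ℚ-path-mono (mkℚ -[1+ a ] b _) (mkℚ (ℤ.+ suc c) d _) h = left◁right
ℚ-path-mono (mkℚ -[1+ a ] b _) (mkℚ -[1+ c ] d _) (ℚ.*<* (-<- h)) =
  inside-left (mirror-◁ (stern-brocot-mono _ _ c d a b ≤-refl ≤-refl (s≤s h)))

increasing⇒↪ : ∀ {L} → IsLinear L → (g : ℚ → Car L)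
  → (∀ p q → p ℚ.< q → lt L (g p) (g q)) → ℚOrd ↪ L
increasing⇒↪ {L} lin g g-mono = record
  { emb = g ; emb-inj = injective ; emb-pres = g-mono ; emb-refl = reflecting }
  where
  open IsStrictTotalOrder lin using (irrefl) renaming (trans to transL)
  injective : ∀ {p q} → g p ≡ g q → p ≡ q
  injective {p} {q} e with ℚ.<-cmp p q
  ... | tri< p<q _ _ = ⊥-elim (irrefl e (g-mono p q p<q))
  ... | tri≈ _ p≡q _ = p≡q
  ... | tri> _ _ q<p = ⊥-elim (irrefl (sym e) (g-mono q p q<p))
  reflecting : ∀ p q → lt L (g p) (g q) → p ℚ.< q
  reflecting p q h with ℚ.<-cmp p q
  ... | tri< p<q _ _ = p<q
  ... | tri≈ _ refl _ = ⊥-elim (irrefl refl h)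
  ... | tri> _ _ q<p = ⊥-elim (irrefl refl (transL h (g-mono q p q<p)))

-- The H-condition yields, for any k, increasing indices σ i > k with
-- Aᵢ ↪ A_{σ i}; together they shift Σω As (resp. Σω* As) into the summands
-- beyond k.
module Beyond (As : ℕ → Ord) (hc : HCond As) (k : ℕ) where
  σ : ℕ → ℕ
  σ zero = proj₁ (hc 0 (suc k))
  σ (suc i) = proj₁ (hc (suc i) (suc (σ i)))

  σ-emb : ∀ i → As i ↪ As (σ i)
  σ-emb zero = proj₂ (proj₂ (hc 0 (suc k)))
  σ-emb (suc i) = proj₂ (proj₂ (hc (suc i) (suc (σ i))))

  σ-step : ∀ i → σ i < σ (suc i)
  σ-step i = proj₁ (proj₂ (hc (suc i) (suc (σ i))))

  σ-beyond : ∀ i → k < σ i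
  σ-beyond zero = proj₁ (proj₂ (hc 0 (suc k)))
  σ-beyond (suc i) = <-trans (σ-beyond i) (σ-step i)

  σ-mono : ∀ i j → i < j → σ i < σ j
  σ-mono i (suc j) (s≤s i≤j) with m≤n⇒m<n∨m≡n i≤j
  ... | inj₁ i<j = <-trans (σ-mono i j i<j) (σ-step j)
  ... | inj₂ refl = σ-step i

  shift : Σ ℕ (Car ∘ As) → Σ ℕ (Car ∘ As)
  shift (i , a) = σ i , _↪_.emb (σ-emb i) a

  shift-ω : ∀ x y → lt (Σω As) x y → lt (Σω As) (shift x) (shift y)
  shift-ω (i , a) (j , b) (inj₁ i<j) = inj₁ (σ-mono i j i<j)
  shift-ω (i , a) (.i , b) (inj₂ (refl , p)) = inj₂ (refl , _↪_.emb-pres (σ-emb i) a b p)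

  shift-ω* : ∀ x y → lt (Σω* As) x y → lt (Σω* As) (shift x) (shift y)
  shift-ω* (i , a) (j , b) (inj₁ j<i) = inj₁ (σ-mono j i j<i)
  shift-ω* (i , a) (.i , b) (inj₂ (refl , p)) = inj₂ (refl , _↪_.emb-pres (σ-emb i) a b p)

ωSum-ω*Sum⇒ℚ↪ : ∀ {L X} → IsLinear L → X ↪ L → IsωSum X → Isω*Sum X → ℚOrd ↪ L
ωSum-ω*Sum⇒ℚ↪ {L} {X} lin ι (As , hsA , hcA , ψ) (Bs , _ , hcB , φ) =
  increasing⇒↪ lin (emb ∘ tree ∘ ℚ-path) (λ p q h → emb-pres _ _ (tree-mono (ℚ-path-mono p q h)))
  where
  open _↪_ ι
  open IsStrictTotalOrder lin using () renaming (trans to transL)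
  module ψ = _≅_ ψ
  module φ = _≅_ φ
  x : Car X
  x = ψ.from (0 , H-point (hsA 0))
  module A = Beyond As hcA 0
  module B = Beyond Bs hcB (proj₁ (φ.to x))
  down up : Car X → Car X
  down y = φ.from (B.shift (φ.to y))
  up y = ψ.from (A.shift (ψ.to y))
  down-mono : ∀ a b → lt X a b → lt X (down a) (down b)
  down-mono a b h = φ.from-mono _ _ (B.shift-ω* _ _ (φ.to-mono a b h))
  up-mono : ∀ a b → lt X a b → lt X (up a) (up b)
  up-mono a b h = ψ.from-mono _ _ (A.shift-ω _ _ (ψ.to-mono a b h))
  below : ∀ y → lt X (down y) x
  below y = subst (lt X (down y)) (φ.from-to x) (φ.from-mono _ _ (inj₁ (B.σ-beyond (proj₁ (φ.to y)))))
  above : ∀ y → lt X x (up y)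
  above y = ψ.from-mono _ _ (inj₁ (A.σ-beyond (proj₁ (ψ.to y))))
  tree : Path → Car X
  tree [] = x
  tree (left ∷ w) = down (tree w)
  tree (right ∷ w) = up (tree w)
  tree-mono : ∀ {w v} → w ◁ v → lt X (tree w) (tree v)
  tree-mono left◁root = below _
  tree-mono root◁right = above _
  tree-mono left◁right = emb-refl _ _ (transL (emb-pres _ _ (below _)) (emb-pres _ _ (above _)))
  tree-mono (inside-left p) = down-mono _ _ (tree-mono p)
  tree-mono (inside-right p) = up-mono _ _ (tree-mono p)

summand↪ : ∀ {L m Ls} → L ≅ FinSum m Ls → ∀ i → i < m → Ls i ↪ L
summand↪ {L} {m} {Ls} iso i i<m = record
  { emb = ι
  ; emb-inj = λ e → component (trans (sym (to-from _)) (trans (cong to e) (to-from _)))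
  ; emb-pres = λ a b p → from-mono _ _ (inj₂ (refl , p))
  ; emb-refl = reflecting }
  where
  open _≅_ iso
  ι : Car (Ls i) → Car L
  ι a = from (i , i<m , a)
  component : ∀ {a b} → (i , i<m , a) ≡ (i , i<m , b) → a ≡ b
  component refl = refl
  reflecting : ∀ a b → lt L (ι a) (ι b) → lt (Ls i) a b
  reflecting a b p with subst₂ (lt (FinSum m Ls)) (to-from _) (to-from _) (to-mono _ _ p)
  ... | inj₁ i<i = ⊥-elim (<-irrefl refl i<i)
  ... | inj₂ (refl , q) = q

summand-exclusive : ∀ {L m Ls} → IsLinear L → Scattered L → L ≅ FinSum m Ls
  → ∀ i → i < m → IsωSum (Ls i) → ¬ Isω*Sum (Ls i)
summand-exclusive lin scattered iso i i<m w w* = scattered (ωSum-ω*Sum⇒ℚ↪ lin (summand↪ iso i i<m) w w*)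

BlockShape : ℕ → (ℕ → Ord) → ℕ → ℕ → Set₁
BlockShape m Ls i k = BlockA m Ls i k ⊎ BlockB m Ls i k ⊎ BlockC m Ls i k ⊎ BlockD m Ls i k

-- The only inputs are that singletons,
-- ω-sums and ω*-sums are pairwise distinct kinds of summands.
module FirstBlock (m : ℕ) (Ls : ℕ → Ord)
  (exclusive : ∀ i → i < m → IsωSum (Ls i) → ¬ Isω*Sum (Ls i)) where

  not-longer : ∀ {i k k′} → IsBlock m Ls i k → IsBlock m Ls i k′ → k < k′ → ⊥
  not-longer {i} {k} {k′} (_ , X) (lift bound′ , Y) k<k′ = clash X Y
    where
    -- s is the first index after the shorter block; it lies in the longer one.
    s : ℕ
    s = suc (i + k)
    i≤s : i ≤ s
    i≤s = m≤n⇒m≤1+n (m≤m+n i k)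
    s≤end : s ≤ i + k′
    s≤end = subst (_≤ i + k′) (+-suc i k) (+-monoʳ-≤ i k<k′)
    s<m : s < m
    s<m = ≤-<-trans s≤end bound′
    i<m : i < m
    i<m = ≤-<-trans (m≤m+n i k′) bound′
    inner : s ≢ m
    inner = <⇒≢ s<m
    i∈X : i ≤ i + k
    i∈X = m≤m+n i k
    i∈Y : i ≤ i + k′
    i∈Y = m≤m+n i k′
    -- Blocks of different types already differ at Lᵢ (or, for (C) against
    -- (D), at Lᵢ₊₁); a shorter block of the same type fails its end
    -- condition at s.
    clash : BlockShape m Ls i k → BlockShape m Ls i k′ → ⊥
    clash (inj₁ (_ , _ , lift (inj₁ e))) _ = inner e
    clash (inj₁ (_ , _ , lift (inj₂ c))) (inj₁ (a′ , _)) =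
      countable-not-singleton {Ls s} c (lower (a′ s i≤s s≤end))
    clash (inj₁ (a , _)) (inj₂ (inj₁ (b′ , _))) =
      ωSum-not-singleton (b′ i ≤-refl i∈Y) (lower (a i ≤-refl i∈X))
    clash (inj₁ (a , _)) (inj₂ (inj₂ (inj₁ (c′ , _)))) =
      ω*Sum-not-singleton (c′ i ≤-refl i∈Y) (lower (a i ≤-refl i∈X))
    clash (inj₁ (a , _)) (inj₂ (inj₂ (inj₂ (_ , w* , _)))) = ω*Sum-not-singleton w* (lower (a i ≤-refl i∈X))
    clash (inj₂ (inj₁ (b , _))) (inj₁ (a′ , _)) =
      ωSum-not-singleton (b i ≤-refl i∈X) (lower (a′ i ≤-refl i∈Y))
    clash (inj₂ (inj₁ (_ , _ , inj₁ (lift e)))) (inj₂ (inj₁ _)) = inner e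
    clash (inj₂ (inj₁ (_ , _ , inj₂ ¬w))) (inj₂ (inj₁ (b′ , _))) = ¬w (b′ s i≤s s≤end)
    clash (inj₂ (inj₁ (b , _))) (inj₂ (inj₂ (inj₁ (c′ , _)))) =
      exclusive i i<m (b i ≤-refl i∈X) (c′ i ≤-refl i∈Y)
    clash (inj₂ (inj₁ (b , _))) (inj₂ (inj₂ (inj₂ (_ , w* , _)))) = exclusive i i<m (b i ≤-refl i∈X) w*
    clash (inj₂ (inj₂ (inj₁ (c , _)))) (inj₁ (a′ , _)) =
      ω*Sum-not-singleton (c i ≤-refl i∈X) (lower (a′ i ≤-refl i∈Y))
    clash (inj₂ (inj₂ (inj₁ (c , _)))) (inj₂ (inj₁ (b′ , _))) =
      exclusive i i<m (b′ i ≤-refl i∈Y) (c i ≤-refl i∈X)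
    clash (inj₂ (inj₂ (inj₁ (_ , _ , inj₁ (lift e))))) (inj₂ (inj₂ _)) = inner e
    clash (inj₂ (inj₂ (inj₁ (_ , _ , inj₂ (lift s+1<m , w*s , ws+1))))) (inj₂ (inj₂ (inj₁ (c′ , _ , end′))))
      with m≤n⇒m<n∨m≡n s≤end
    ... | inj₁ s<end = exclusive (suc s) s+1<m ws+1 (c′ (suc s) (m≤n⇒m≤1+n i≤s) s<end)
    ... | inj₂ s≡end with end′
    ...   | inj₁ (lift e) = <⇒≢ s+1<m (trans (cong suc s≡end) e)
    ...   | inj₂ (_ , w*next , _) =
      exclusive (suc s) s+1<m ws+1 (subst (Isω*Sum ∘ Ls) (cong suc (sym s≡end)) w*next)
    clash (inj₂ (inj₂ (inj₁ (_ , _ , inj₂ (_ , w*s , _))))) (inj₂ (inj₂ (inj₂ (lift k′≡1 , _ , ws)))) =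
      exclusive s s<m (subst (IsωSum ∘ Ls) (cong suc i≡i+k) ws) w*s
      where
      i≡i+k : i ≡ i + k
      i≡i+k = sym (trans (cong (i +_) (n<1⇒n≡0 (subst (k <_) k′≡1 k<k′))) (+-identityʳ i))
    clash (inj₂ (inj₂ (inj₂ (_ , w* , _)))) (inj₁ (a′ , _)) = ω*Sum-not-singleton w* (lower (a′ i ≤-refl i∈Y))
    clash (inj₂ (inj₂ (inj₂ (_ , w* , _)))) (inj₂ (inj₁ (b′ , _))) = exclusive i i<m (b′ i ≤-refl i∈Y) w*
    clash (inj₂ (inj₂ (inj₂ (_ , _ , ws)))) (inj₂ (inj₂ (inj₁ (c′ , _)))) =
      exclusive (suc i) (≤-<-trans i+1≤end bound′) ws (c′ (suc i) (n≤1+n i) i+1≤end)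
      where
      i+1≤end : suc i ≤ i + k′
      i+1≤end = ≤-trans (s≤s (m≤m+n i k)) s≤end
    clash (inj₂ (inj₂ (inj₂ (lift k≡1 , _)))) (inj₂ (inj₂ (inj₂ (lift k′≡1 , _)))) =
      <-irrefl (trans k≡1 (sym k′≡1)) k<k′

  -- Inside a run L₀, …, Lᵢ of ω-sums no block of type (B) can start at i + 1:
  -- its condition asks Lᵢ₋₁ to be an ω*-sum.
  ω-run-no-prevB : ∀ i → i < m → (∀ j → j ≤ i → IsωSum (Ls j)) → ¬ PrevB Ls (suc i)
  ω-run-no-prevB zero _ _ (lift ())
  ω-run-no-prevB (suc i) i+1<m run (_ , w*) = exclusive i (<-trans (n<1+n i) i+1<m) (run i (n≤1+n i)) w*

  -- A block
  -- starting at i + 1 ≤ K either begins with a summand of another kind than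
  -- the summands of the first block, or its condition on the preceding
  -- summands contradicts the first block.
  inside-first-block : ∀ {K i k} → IsBlock m Ls 0 K → IsBlock m Ls (suc i) k → suc i ≤ K → ⊥
  inside-first-block {K} {i} {k} (lift boundY , Y) (lift bound , X) i<K = clash Y X
    where
    i+1∈X : suc i ≤ suc i + k
    i+1∈X = m≤m+n (suc i) k
    i+1<m : suc i < m
    i+1<m = ≤-<-trans i+1∈X bound
    i≤K : i ≤ K
    i≤K = <⇒≤ i<K
    i+2<m : k ≡ 1 → suc (suc i) < m
    i+2<m k≡1 = subst (_< m) (trans (cong (λ x → suc i + x) k≡1) (+-comm (suc i) 1)) bound
    clash-D : i ≡ 0 → IsωSum (Ls (suc i))
      → BlockShape m Ls (suc i) k → ⊥
    clash-D i≡0 w (inj₁ (a′ , _)) = ωSum-not-singleton w (lower (a′ (suc i) ≤-refl i+1∈X))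
    clash-D i≡0 w (inj₂ (inj₁ (_ , prev , _))) = lower (subst (PrevB Ls ∘ suc) i≡0 prev)
    clash-D i≡0 w (inj₂ (inj₂ (inj₁ (c′ , _)))) = exclusive (suc i) i+1<m w (c′ (suc i) ≤-refl i+1∈X)
    clash-D i≡0 w (inj₂ (inj₂ (inj₂ (_ , w* , _)))) = exclusive (suc i) i+1<m w w*
    clash : BlockShape m Ls 0 K → BlockShape m Ls (suc i) k → ⊥
    clash (inj₁ (a , _)) (inj₁ (_ , lift card , _)) =
      countable-not-singleton {Ls i} card (lower (a i z≤n i≤K))
    clash (inj₁ (a , _)) (inj₂ (inj₁ (b′ , _))) =
      ωSum-not-singleton (b′ (suc i) ≤-refl i+1∈X) (lower (a (suc i) z≤n i<K))
    clash (inj₁ (a , _)) (inj₂ (inj₂ (inj₁ (c′ , _)))) =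
      ω*Sum-not-singleton (c′ (suc i) ≤-refl i+1∈X) (lower (a (suc i) z≤n i<K))
    clash (inj₁ (a , _)) (inj₂ (inj₂ (inj₂ (_ , w* , _)))) =
      ω*Sum-not-singleton w* (lower (a (suc i) z≤n i<K))
    clash (inj₂ (inj₁ (b , _))) (inj₁ (a′ , _)) =
      ωSum-not-singleton (b (suc i) z≤n i<K) (lower (a′ (suc i) ≤-refl i+1∈X))
    clash (inj₂ (inj₁ (b , _))) (inj₂ (inj₁ (_ , prev , _))) =
      ω-run-no-prevB i (<-trans (n<1+n i) i+1<m) (λ j j≤i → b j z≤n (≤-trans j≤i i≤K)) prev
    clash (inj₂ (inj₁ (b , _))) (inj₂ (inj₂ (inj₁ (c′ , _)))) =
      exclusive (suc i) i+1<m (b (suc i) z≤n i<K) (c′ (suc i) ≤-refl i+1∈X)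
    clash (inj₂ (inj₁ (b , _))) (inj₂ (inj₂ (inj₂ (_ , w* , _)))) =
      exclusive (suc i) i+1<m (b (suc i) z≤n i<K) w*
    clash (inj₂ (inj₂ (inj₁ (c , _)))) (inj₁ (a′ , _)) =
      ω*Sum-not-singleton (c (suc i) z≤n i<K) (lower (a′ (suc i) ≤-refl i+1∈X))
    clash (inj₂ (inj₂ (inj₁ (c , _)))) (inj₂ (inj₁ (b′ , _))) =
      exclusive (suc i) i+1<m (b′ (suc i) ≤-refl i+1∈X) (c (suc i) z≤n i<K)
    clash (inj₂ (inj₂ (inj₁ (c , _)))) (inj₂ (inj₂ (inj₁ (_ , prev , _)))) = prev (c i z≤n i≤K)
    clash (inj₂ (inj₂ (inj₁ (c , _ , endY)))) (inj₂ (inj₂ (inj₂ (lift k≡1 , _ , w)))) with m≤n⇒m<n∨m≡n i<K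
    ... | inj₁ i+2≤K = exclusive (suc (suc i)) (≤-<-trans i+2≤K boundY) w (c (suc (suc i)) z≤n i+2≤K)
    ... | inj₂ i+1≡K with endY
    ...   | inj₁ (lift e) = <⇒≢ (i+2<m k≡1) (trans (cong suc i+1≡K) e)
    ...   | inj₂ (_ , w*K+1 , _) =
      exclusive (suc (suc i)) (i+2<m k≡1) w (subst (Isω*Sum ∘ Ls) (cong suc (sym i+1≡K)) w*K+1)
    clash (inj₂ (inj₂ (inj₂ (lift K≡1 , _ , w₁)))) x = clash-D i≡0 (subst (IsωSum ∘ Ls ∘ suc) (sym i≡0) w₁) x
      where
      i≡0 : i ≡ 0
      i≡0 = n≤0⇒n≡0 (≤-pred (subst (suc i ≤_) K≡1 i<K))

  first-block-unique : ∀ {K i k} → IsBlock m Ls 0 K → IsBlock m Ls i k → i ≤ K → i ≡ 0 × k ≡ K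
  first-block-unique {K} {zero} {k} B₀ X _ with <-cmp k K
  ... | tri< k<K _ _ = ⊥-elim (not-longer X B₀ k<K)
  ... | tri≈ _ k≡K _ = refl , k≡K
  ... | tri> _ _ K<k = ⊥-elim (not-longer B₀ X K<k)
  first-block-unique {i = suc i} B₀ X i<K = ⊥-elim (inside-first-block B₀ X i<K)

-- For n ≤ m, the blocks of Lₙ + … + L_{m−1} correspond to
-- those of L₀ + … + L_{m−1} starting at n or later: the body, length and
-- end conditions of a block are invariant under the shift i ↦ n + i; only
-- the condition on the preceding summands can refer to the removed part.

-- The components of a block: its summands all satisfy P, and the
-- conditions (A)–(C) at the index e just after it.
Body : (Ord → Set₁) → (ℕ → Ord) → ℕ → ℕ → Set₁
Body P Ls i k = ∀ j → i ≤ j → j ≤ i + k → P (Ls j)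

EndA EndB EndC : ℕ → (ℕ → Ord) → ℕ → Set₁
EndA m Ls e = L1 (e ≡ m ⊎ CardOmega (Ls e))
EndB m Ls e = L1 (e ≡ m) ⊎ ¬ IsωSum (Ls e)
EndC m Ls e = L1 (e ≡ m) ⊎ (L1 (suc e < m) × Isω*Sum (Ls e) × IsωSum (Ls (suc e)))

module Shift (m n : ℕ) (Ls : ℕ → Ord) (n≤m : n ≤ m) where

  T : ℕ → Ord
  T j = Ls (n + j)

  shift-≡ : ∀ {e} → e ≡ m ∸ n → n + e ≡ m
  shift-≡ e≡ = trans (cong (n +_) e≡) (m+[n∸m]≡n n≤m)

  unshift-≡ : ∀ {e} → n + e ≡ m → e ≡ m ∸ n
  unshift-≡ {e} ≡m = sym (trans (cong (_∸ n) (sym ≡m)) (m+n∸m≡n n e))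

  shift-< : ∀ {e} → e < m ∸ n → n + e < m
  shift-< e< = subst (n + _ <_) (m+[n∸m]≡n n≤m) (+-monoʳ-< n e<)

  unshift-< : ∀ {e} → n + e < m → e < m ∸ n
  unshift-< {e} <m = +-cancelˡ-< n e (m ∸ n) (subst (n + e <_) (sym (m+[n∸m]≡n n≤m)) <m)

  after : ∀ e → n + suc e ≡ suc (n + e)
  after e = +-suc n e

  end-index : ∀ i k → n + suc (i + k) ≡ suc (n + i + k)
  end-index i k = trans (after (i + k)) (cong suc (sym (+-assoc n i k)))

  Ls-after : ∀ e → T (suc e) ≡ Ls (suc (n + e))
  Ls-after e = cong Ls (after e)

  body-up : ∀ P {i k} → Body P T i k → Body P Ls (n + i) k
  body-up P {i} {k} body j n+i≤j j≤end = subst (P ∘ Ls) (m+[n∸m]≡n n≤j) (body (j ∸ n) i≤ ≤i+k)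
    where
    n≤j : n ≤ j
    n≤j = ≤-trans (m≤m+n n i) n+i≤j
    i≤ : i ≤ j ∸ n
    i≤ = +-cancelˡ-≤ n i (j ∸ n) (subst (n + i ≤_) (sym (m+[n∸m]≡n n≤j)) n+i≤j)
    ≤i+k : j ∸ n ≤ i + k
    ≤i+k = +-cancelˡ-≤ n (j ∸ n) (i + k)
      (subst₂ _≤_ (sym (m+[n∸m]≡n n≤j)) (+-assoc n i k) j≤end)

  body-down : ∀ P {i k} → Body P Ls (n + i) k → Body P T i k
  body-down P {i} {k} body j i≤j j≤end =
    body (n + j) (+-monoʳ-≤ n i≤j) (subst (n + j ≤_) (sym (+-assoc n i k)) (+-monoʳ-≤ n j≤end))

  endA-up : ∀ {e} → EndA (m ∸ n) T e → EndA m Ls (n + e)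
  endA-up (lift (inj₁ e≡)) = lift (inj₁ (shift-≡ e≡))
  endA-up (lift (inj₂ c)) = lift (inj₂ c)

  endA-down : ∀ {e} → EndA m Ls (n + e) → EndA (m ∸ n) T e
  endA-down (lift (inj₁ ≡m)) = lift (inj₁ (unshift-≡ ≡m))
  endA-down (lift (inj₂ c)) = lift (inj₂ c)

  endB-up : ∀ {e} → EndB (m ∸ n) T e → EndB m Ls (n + e)
  endB-up (inj₁ (lift e≡)) = inj₁ (lift (shift-≡ e≡))
  endB-up (inj₂ ¬w) = inj₂ ¬w

  endB-down : ∀ {e} → EndB m Ls (n + e) → EndB (m ∸ n) T e
  endB-down (inj₁ (lift ≡m)) = inj₁ (lift (unshift-≡ ≡m))
  endB-down (inj₂ ¬w) = inj₂ ¬w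

  endC-up : ∀ {e} → EndC (m ∸ n) T e → EndC m Ls (n + e)
  endC-up (inj₁ (lift e≡)) = inj₁ (lift (shift-≡ e≡))
  endC-up {e} (inj₂ (lift e+1< , w* , w)) =
    inj₂ (lift (subst (_< m) (after e) (shift-< e+1<)) , w* , subst IsωSum (Ls-after e) w)

  endC-down : ∀ {e} → EndC m Ls (n + e) → EndC (m ∸ n) T e
  endC-down (inj₁ (lift ≡m)) = inj₁ (lift (unshift-≡ ≡m))
  endC-down {e} (inj₂ (lift e+1< , w* , w)) =
    inj₂ (lift (unshift-< (subst (_< m) (sym (after e)) e+1<)) , w* , subst IsωSum (sym (Ls-after e)) w)

  D-up : ∀ {i k} → BlockD (m ∸ n) T i k → BlockD m Ls (n + i) k
  D-up {i} (k≡1 , w* , w) = k≡1 , w* , subst IsωSum (Ls-after i) w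

  D-down : ∀ {i k} → BlockD m Ls (n + i) k → BlockD (m ∸ n) T i k
  D-down {i} (k≡1 , w* , w) = k≡1 , w* , subst IsωSum (sym (Ls-after i)) w

  block-up : ∀ {i k}
    → (BlockA (m ∸ n) T i k → L1 (PrevA Ls (n + i)))
    → (BlockB (m ∸ n) T i k → PrevB Ls (n + i))
    → (BlockC (m ∸ n) T i k → PrevC Ls (n + i))
    → IsBlock (m ∸ n) T i k → IsBlock m Ls (n + i) k
  block-up {i} {k} pa pb pc (lift bound , X) = lift bound′ , blocks X
    where
    bound′ : n + i + k < m
    bound′ = subst (_< m) (sym (+-assoc n i k)) (shift-< bound)
    end : ∀ {E : ℕ → (ℕ → Ord) → ℕ → Set₁} → E m Ls (n + suc (i + k)) → E m Ls (suc (n + i + k))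
    end {E} = subst (E m Ls) (end-index i k)
    blocks : BlockShape (m ∸ n) T i k → BlockShape m Ls (n + i) k
    blocks (inj₁ X@(body , _ , e)) = inj₁ (body-up (L1 ∘ IsSingleton) body , pa X , end {EndA} (endA-up e))
    blocks (inj₂ (inj₁ X@(body , _ , e))) = inj₂ (inj₁ (body-up IsωSum body , pb X , end {EndB} (endB-up e)))
    blocks (inj₂ (inj₂ (inj₁ X@(body , _ , e)))) =
      inj₂ (inj₂ (inj₁ (body-up Isω*Sum body , pc X , end {EndC} (endC-up e))))
    blocks (inj₂ (inj₂ (inj₂ X))) = inj₂ (inj₂ (inj₂ (D-up X)))

  block-down : ∀ {i k}
    → (PrevA Ls (n + i) → PrevA T i) → (PrevB Ls (n + i) → PrevB T i) → (PrevC Ls (n + i) → PrevC T i)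
    → IsBlock m Ls (n + i) k → IsBlock (m ∸ n) T i k
  block-down {i} {k} pa pb pc (lift bound , X) =
    lift (unshift-< (subst (_< m) (+-assoc n i k) bound)) , blocks X
    where
    end : ∀ {E : ℕ → (ℕ → Ord) → ℕ → Set₁} → E m Ls (suc (n + i + k)) → E m Ls (n + suc (i + k))
    end {E} = subst (E m Ls) (sym (end-index i k))
    blocks : BlockShape m Ls (n + i) k → BlockShape (m ∸ n) T i k
    blocks (inj₁ (body , p , e)) =
      inj₁ (body-down (L1 ∘ IsSingleton) body , lift (pa (lower p)) , endA-down (end {EndA} e))
    blocks (inj₂ (inj₁ (body , p , e))) =
      inj₂ (inj₁ (body-down IsωSum body , pb p , endB-down (end {EndB} e)))
    blocks (inj₂ (inj₂ (inj₁ (body , p , e)))) =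
      inj₂ (inj₂ (inj₁ (body-down Isω*Sum body , pc p , endC-down (end {EndC} e))))
    blocks (inj₂ (inj₂ (inj₂ X))) = inj₂ (inj₂ (inj₂ (D-down X)))

  prevA-up : ∀ i → PrevA T (suc i) → PrevA Ls (n + suc i)
  prevA-up i = subst (PrevA Ls) (sym (after i))

  prevA-down : ∀ i → PrevA Ls (n + suc i) → PrevA T (suc i)
  prevA-down i = subst (PrevA Ls) (after i)

  prevC-up : ∀ i → PrevC T (suc i) → PrevC Ls (n + suc i)
  prevC-up i = subst (PrevC Ls) (sym (after i))

  prevC-down : ∀ i → PrevC Ls (n + suc i) → PrevC T (suc i)
  prevC-down i = subst (PrevC Ls) (after i)

  prevB-up : ∀ i → PrevB T (suc (suc i)) → PrevB Ls (n + suc (suc i))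
  prevB-up i (w , w*) = subst (PrevB Ls) (sym (trans (after (suc i)) (cong suc (after i))))
    (subst IsωSum (Ls-after i) w , w*)

  prevB-down : ∀ i → PrevB Ls (n + suc (suc i)) → PrevB T (suc (suc i))
  prevB-down i p with subst (PrevB Ls) (trans (after (suc i)) (cong suc (after i))) p
  ... | w , w* = subst IsωSum (sym (Ls-after i)) w , w*

module AfterFirstBlock (m : ℕ) (Ls : ℕ → Ord)
  (exclusive : ∀ i → i < m → IsωSum (Ls i) → ¬ Isω*Sum (Ls i))
  (minimal : ∀ j → suc j < m → IsSingleton (Ls j) → ¬ IsωSum (Ls (suc j)))
  (n′ : ℕ) (n≤m : suc n′ ≤ m) (B₀ : IsBlock m Ls 0 n′) where

  n : ℕ
  n = suc n′

  open Shift m n Ls n≤m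
  open FirstBlock m Ls exclusive using (first-block-unique)

  n′<m : n′ < m
  n′<m = n≤m

  rest-nonempty : ∀ {e} → n + e < m → n < m
  rest-nonempty {e} = ≤-<-trans (m≤m+n n e)

  at-n : ∀ {ℓ} (P : ℕ → Set ℓ) → P (n + 0) → P n
  at-n P = subst P (+-identityʳ n)

  at-n+0 : ∀ {ℓ} (P : ℕ → Set ℓ) → P n → P (n + 0)
  at-n+0 P = subst P (sym (+-identityʳ n))

  -- How B₀ constrains the summands following it.  The block conditions at
  -- the seam refer to the last summand L_{n′} of B₀.

  seam-A : n < m → IsSingleton (Ls n) → CardOmega (Ls n′)
  seam-A n<m s with proj₂ B₀
  ... | inj₁ (_ , _ , lift (inj₁ e)) = ⊥-elim (<⇒≢ n<m e)
  ... | inj₁ (_ , _ , lift (inj₂ c)) = ⊥-elim (countable-not-singleton {Ls n} c s)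
  ... | inj₂ (inj₁ (b , _)) = ωSum-countable (b n′ z≤n ≤-refl)
  ... | inj₂ (inj₂ (inj₁ (_ , _ , inj₁ (lift e)))) = ⊥-elim (<⇒≢ n<m e)
  ... | inj₂ (inj₂ (inj₁ (_ , _ , inj₂ (_ , w*n , _)))) = ⊥-elim (ω*Sum-not-singleton w*n s)
  ... | inj₂ (inj₂ (inj₂ (lift n′≡1 , _ , w₁))) = subst (CardOmega ∘ Ls) (sym n′≡1) (ωSum-countable w₁)

  -- If B₀ is followed by an ω-sum, B₀ is of type (D): L_{n′} is an ω-sum
  -- preceded by an ω*-sum.
  seam-B : n < m → IsωSum (Ls n) → PrevB Ls n
  seam-B n<m w with proj₂ B₀
  ... | inj₁ (a , _) = ⊥-elim (minimal n′ n<m (lower (a n′ z≤n ≤-refl)) w)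
  ... | inj₂ (inj₁ (_ , _ , inj₁ (lift e))) = ⊥-elim (<⇒≢ n<m e)
  ... | inj₂ (inj₁ (_ , _ , inj₂ ¬w)) = ⊥-elim (¬w w)
  ... | inj₂ (inj₂ (inj₁ (_ , _ , inj₁ (lift e)))) = ⊥-elim (<⇒≢ n<m e)
  ... | inj₂ (inj₂ (inj₁ (_ , _ , inj₂ (_ , w*n , _)))) = ⊥-elim (exclusive n n<m w w*n)
  ... | inj₂ (inj₂ (inj₂ (lift n′≡1 , w*₀ , w₁))) = subst (PrevB Ls ∘ suc) (sym n′≡1) (w₁ , w*₀)

  -- If the last summand of B₀ is an ω*-sum and B₀ is not all of L, then B₀
  -- is of type (C) and is followed by an ω*-sum and an ω-sum.
  last-ω* : n < m → Isω*Sum (Ls n′) → L1 (suc n < m) × Isω*Sum (Ls n) × IsωSum (Ls (suc n))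
  last-ω* n<m w* with proj₂ B₀
  ... | inj₁ (a , _) = ⊥-elim (ω*Sum-not-singleton w* (lower (a n′ z≤n ≤-refl)))
  ... | inj₂ (inj₁ (b , _)) = ⊥-elim (exclusive n′ n′<m (b n′ z≤n ≤-refl) w*)
  ... | inj₂ (inj₂ (inj₁ (_ , _ , inj₁ (lift e)))) = ⊥-elim (<⇒≢ n<m e)
  ... | inj₂ (inj₂ (inj₁ (_ , _ , inj₂ after-B₀))) = after-B₀
  ... | inj₂ (inj₂ (inj₂ (lift n′≡1 , _ , w₁))) =
    ⊥-elim (exclusive 1 (subst (_< m) n′≡1 n′<m) w₁ (subst (Isω*Sum ∘ Ls) n′≡1 w*))

  -- Hence a block of type (C) cannot start right after B₀ if L_{n′} is an
  -- ω*-sum: it would contain Lₙ₊₁, or end before the ω-sum Lₙ₊₁.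
  seam-C : ∀ {k} → n < m → BlockC (m ∸ n) T 0 k → ¬ Isω*Sum (Ls n′)
  seam-C {k} n<m (body , _ , end) w* with last-ω* n<m w*
  ... | lift n+1<m , _ , w =
    exclusive (suc n) n+1<m w (subst Isω*Sum (cong Ls (+-comm n 1)) (second k body end))
    where
    second : ∀ k → Body Isω*Sum T 0 k → EndC (m ∸ n) T (suc k) → Isω*Sum (T 1)
    second (suc k) body _ = body 1 z≤n (s≤s z≤n)
    second zero _ (inj₁ (lift e)) = ⊥-elim (<⇒≢ n+1<m (trans (+-comm 1 n) (shift-≡ e)))
    second zero _ (inj₂ (_ , w*₁ , _)) = w*₁

  -- and no block of type (B) can start at n + 1.
  seam-no-B : n < m → IsωSum (Ls n) → ¬ Isω*Sum (Ls n′)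
  seam-no-B n<m w w* = exclusive n n<m w (proj₁ (proj₂ (last-ω* n<m w*)))

  rest-block-up : ∀ i k → IsBlock (m ∸ n) T i k → IsBlock m Ls (n + i) k
  rest-block-up zero k X@(lift bound , _) = block-up
    (λ (a , _ , _) → lift (at-n+0 (PrevA Ls) (seam-A n<m (at-n (IsSingleton ∘ Ls) (lower (a 0 z≤n z≤n))))))
    (λ (b , _ , _) → at-n+0 (PrevB Ls) (seam-B n<m (at-n (IsωSum ∘ Ls) (b 0 z≤n z≤n))))
    (λ C → at-n+0 (PrevC Ls) (seam-C n<m C))
    X
    where
    n<m : n < m
    n<m = rest-nonempty (shift-< bound)
  rest-block-up (suc zero) k X = block-up
    (λ (_ , p , _) → lift (prevA-up 0 (lower p)))
    (λ (_ , p , _) → ⊥-elim (lower p))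
    (λ (_ , p , _) → prevC-up 0 p)
    X
  rest-block-up (suc (suc i)) k X = block-up
    (λ (_ , p , _) → lift (prevA-up (suc i) (lower p)))
    (λ (_ , p , _) → prevB-up i p)
    (λ (_ , p , _) → prevC-up (suc i) p)
    X

  rest-block-down : ∀ i k → IsBlock m Ls (n + i) k → IsBlock (m ∸ n) T i k
  rest-block-down zero k X = block-down (λ _ → tt) (λ _ → lift tt) (λ _ → lift tt) X
  rest-block-down (suc zero) k X@(lift bound , _) = block-down (prevA-down 0) no-B (prevC-down 0) X
    where
    no-B : PrevB Ls (n + 1) → PrevB T 1
    no-B p with subst (PrevB Ls) (+-comm n 1) p
    ... | w , w* = ⊥-elim (seam-no-B (rest-nonempty (subst (_< m) (+-assoc n 1 k) bound)) w w*)
  rest-block-down (suc (suc i)) k X = block-down (prevA-down (suc i)) (prevB-down i) (prevC-down (suc i)) X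

  blocks-after-B₀ : ∀ i k → IsBlock m Ls i k → ¬ (i ≡ 0 × k ≡ n′)
    → Σ ℕ (λ i′ → (i ≡ n + i′) × IsBlock (m ∸ n) T i′ k)
  blocks-after-B₀ i k X not-B₀ with n ≤? i
  ... | no n≰i = ⊥-elim (not-B₀ (first-block-unique B₀ X (≤-pred (≰⇒> n≰i))))
  ... | yes n≤i = i ∸ n , i≡ , rest-block-down (i ∸ n) k (subst (λ a → IsBlock m Ls a k) i≡ X)
    where
    i≡ : i ≡ n + (i ∸ n)
    i≡ = sym (m+[n∸m]≡n n≤i)

lemma6p3 : (m : ℕ) (L : Ord) → IsLinear L → Countable L → Scattered L → mIs L m
    → (Ls : ℕ → Ord) → (∀ i → i < m → IsH (Ls i)) → L ≅ FinSum m Ls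
    → (n : ℕ) → 0 < n → n ≤ m → IsBlock m Ls 0 (n ∸ 1)
    → ((∀ i k → IsBlock (m ∸ n) (λ j → Ls (n + j)) i k → IsBlock m Ls (n + i) k)
    × (∀ i k → IsBlock m Ls i k → ¬ (i ≡ 0 × k ≡ n ∸ 1)
    → Σ ℕ (λ i′ → (i ≡ n + i′) × IsBlock (m ∸ n) (λ j → Ls (n + j)) i′ k)))
lemma6p3 _ _ _ _ _ _ _ _ _ zero () _ _
lemma6p3 m _ linear _ scattered least Ls inH iso (suc n′) _ n≤m B₀ =
  rest-block-up , blocks-after-B₀
  where
  open AfterFirstBlock m Ls (summand-exclusive linear scattered iso)
    (singleton-before-ωSum least iso inH) n′ n≤m B₀
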